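{- Let $n\ge 2$ and let $O$ be an ogog triangle of index $n$. Then there is an ogog triangle $H$ of index $n$ such that, for every cube position $(i,j,k)$ of the two-color pyramid $\mathrm{pyr}(O)$, the cube at position $(n-i,k,j)$ of $\mathrm{pyr}(H)$ is white if and only if the cube at $(i,j,k)$ of $\mathrm{pyr}(O)$ is gray. (That is, swapping the two colors of $\mathrm{pyr}(O)$ and moving each cube $(i,j,k)$ to $(n-i,k,j)$ yields the pyramid of another ogog triangle; this map is an involution on ogog triangles of index $n$.)
   Context: An ogog triangle of index $n$ is an array of nonnegative integers $O(i,j)$, $1\le j\le i\le n-1$, such that: $0\le O(i,j)\le n-i$; $O(i,j)\le O(i,j+1)$ whenever both are defined (rows weakly increasing); $O(i,j)\ge O(i+1,j)$ whenever both are defined (columns weakly decreasing); and $O(i,j)\le O(i+1,j+1)+1$ whenever both are defined. The two-color pyramid $\mathrm{pyr}(O)$ is the set of cube positions $(i,j,k)$ with $1\le j\le i\le n-1$ and $1\le k\le n-i$, where the cube at $(i,j,k)$ is colored white if $k\le O(i,j)$ and gray otherwise (so the tower at $(i,j)$ has $O(i,j)$ white cubes below $n-i-O(i,j)$ gray cubes). Note that $(i,j,k)\mapsto(n-i,k,j)$ is a bijection of this set of positions onto itself. -}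

module Defs where

open import Data.Nat using (ℕ; _≤_; _<_; _∸_; _+_)
open import Data.Product using (_×_)

-- An ogog triangle of index n: an array O(i,j) for 1 ≤ j ≤ i ≤ n-1,
-- represented as a function ℕ → ℕ → ℕ whose values outside this range
-- are irrelevant (all conditions are only imposed inside the range).
InRange : ℕ → ℕ → ℕ → Set
InRange n i j = (1 ≤ j) × (j ≤ i) × (i ≤ n ∸ 1)

record IsOgog (n : ℕ) (O : ℕ → ℕ → ℕ) : Set where
  field
    bounded  : ∀ i j → InRange n i j → O i j ≤ n ∸ i
    rowInc   : ∀ i j → InRange n i j → InRange n i (j + 1) → O i j ≤ O i (j + 1)
    colDec   : ∀ i j → InRange n i j → InRange n (i + 1) j → O (i + 1) j ≤ O i j
    diagCond : ∀ i j → InRange n i j → InRange n (i + 1) (j + 1) →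
               O i j ≤ O (i + 1) (j + 1) + 1

IsCubePos : ℕ → ℕ → ℕ → ℕ → Set
IsCubePos n i j k = InRange n i j × (1 ≤ k) × (k ≤ n ∸ i)

White : (O : ℕ → ℕ → ℕ) → ℕ → ℕ → ℕ → Set
White O i j k = k ≤ O i j

Gray : (O : ℕ → ℕ → ℕ) → ℕ → ℕ → ℕ → Set
Gray O i j k = O i j < k

module Submission where

open import Defs
open import Data.Nat using (ℕ; zero; suc; _+_; _∸_; _≤_; _<_; _<?_; z≤n; s≤s)
open import Data.Nat.Properties
open import Data.Product using (Σ; _×_; _,_)
open import Data.Sum using (_⊎_; inj₁; inj₂)
open import Data.Empty using (⊥-elim)
open import Function.Bundles using (_⇔_; mk⇔)
open import Relation.Nullary using (yes; no)
open import Relation.Binary.PropositionalEquality using (_≡_; refl; sym; subst; subst₂)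

-- Since the rows of O increase, the cubes of height k that are gray in row i of pyr(O)
-- are exactly those in the columns j ≤ h for some h; the transposed triangle is
-- H(n − i, k) := h, the last column j ≤ i with O(i,j) < k (or 0).  The three
-- inequalities defining an ogog triangle then pass from O to H: rows of H increase
-- because h grows with k, columns of H decrease because the columns of O do, and the
-- diagonal condition for H is the diagonal condition for O read along the other axis.

lastBelow : (ℕ → ℕ) → ℕ → ℕ → ℕ
lastBelow f k zero = zero
lastBelow f k (suc m) with f (suc m) <? k
... | yes _ = suc m
... | no  _ = lastBelow f k m

lastBelow-≤ : ∀ f k m → lastBelow f k m ≤ m
lastBelow-≤ f k zero = z≤n
lastBelow-≤ f k (suc m) with f (suc m) <? k
... | yes _ = ≤-refl
... | no  _ = m≤n⇒m≤1+n (lastBelow-≤ f k m)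

lastBelow-witness : ∀ f k m →
  lastBelow f k m ≡ 0 ⊎ (1 ≤ lastBelow f k m × f (lastBelow f k m) < k)
lastBelow-witness f k zero = inj₁ refl
lastBelow-witness f k (suc m) with f (suc m) <? k
... | yes fm<k = inj₂ (s≤s z≤n , fm<k)
... | no  _    = lastBelow-witness f k m

≤-lastBelow : ∀ f k {m j} → j ≤ m → f j < k → j ≤ lastBelow f k m
≤-lastBelow f k {zero}  j≤m fj<k = j≤m
≤-lastBelow f k {suc m} j≤m fj<k with f (suc m) <? k
... | yes _ = j≤m
... | no fm≮k with m≤n⇒m<n∨m≡n j≤m
...   | inj₁ (s≤s j≤m′) = ≤-lastBelow f k j≤m′ fj<k
...   | inj₂ refl       = ⊥-elim (fm≮k fj<k)

MonotoneOn : ℕ → (ℕ → ℕ) → Set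
MonotoneOn m f = ∀ {x y} → 1 ≤ x → x ≤ y → y ≤ m → f x ≤ f y

monotoneOn-fromStep : ∀ {m f} → (∀ {x} → 1 ≤ x → suc x ≤ m → f x ≤ f (suc x)) →
                      MonotoneOn m f
monotoneOn-fromStep step {y = zero} () z≤n _
monotoneOn-fromStep step {y = suc y} 1≤x x≤y y≤m with m≤n⇒m<n∨m≡n x≤y
... | inj₂ refl        = ≤-refl
... | inj₁ (s≤s x≤y′) =
  ≤-trans (monotoneOn-fromStep step 1≤x x≤y′ (≤-trans (n≤1+n y) y≤m))
          (step (≤-trans 1≤x x≤y′) y≤m)

≤-lastBelow⇔ : ∀ {m f k j} → MonotoneOn m f → 1 ≤ j → j ≤ m →
               (j ≤ lastBelow f k m ⇔ f j < k)
≤-lastBelow⇔ {m} {f} {k} {j} mono 1≤j j≤m = mk⇔ to (≤-lastBelow f k j≤m)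
  where
  to : j ≤ lastBelow f k m → f j < k
  to j≤h with lastBelow-witness f k m
  ... | inj₁ h≡0 = ⊥-elim (1+n≰n (≤-trans 1≤j (subst (j ≤_) h≡0 j≤h)))
  ... | inj₂ (_ , fh<k) = ≤-<-trans (mono 1≤j j≤h (lastBelow-≤ f k m)) fh<k

lastBelow-mono : ∀ {f g k k′ m m′} → (∀ {j} → 1 ≤ j → j ≤ m → g j ≤ f j) →
                 k ≤ k′ → m ≤ m′ → lastBelow f k m ≤ lastBelow g k′ m′
lastBelow-mono {f} {g} {k} {k′} {m} g≤f k≤k′ m≤m′ with lastBelow-witness f k m
... | inj₁ h≡0 = subst (_≤ _) (sym h≡0) z≤n
... | inj₂ (1≤h , fh<k) =
  let h≤m = lastBelow-≤ f k m in
  ≤-lastBelow g k′ (≤-trans h≤m m≤m′)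
    (≤-<-trans (g≤f 1≤h h≤m) (<-≤-trans fh<k k≤k′))

lastBelow-shift : ∀ {f g k m} → (∀ {j} → 1 ≤ j → j ≤ m → f j ≤ g (suc j) + 1) →
                  lastBelow g k (suc m) ≤ lastBelow f (k + 1) m + 1
lastBelow-shift {f} {g} {k} {m} f≤g+1
  with lastBelow g k (suc m) | lastBelow-≤ g k (suc m) | lastBelow-witness g k (suc m)
... | .0 | _ | inj₁ refl = z≤n
... | suc zero | _ | inj₂ _ = m≤n+m 1 _
... | suc (suc t) | s≤s t<m | inj₂ (_ , gt<k) =
  ≤-trans (s≤s t<h) (≤-reflexive (+-comm 1 (lastBelow f (k + 1) m)))
  where
  t<h : suc t ≤ lastBelow f (k + 1) m
  t<h = ≤-lastBelow f (k + 1) t<m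
          (≤-<-trans (f≤g+1 (s≤s z≤n) t<m) (+-monoˡ-< 1 gt<k))

∸-suc-step : ∀ {n a} → a < n → n ∸ a ≡ suc (n ∸ suc a)
∸-suc-step {suc n} {zero}  _         = refl
∸-suc-step {suc n} {suc a} (s≤s a<n) = ∸-suc-step a<n

module Transpose (n : ℕ) (O : ℕ → ℕ → ℕ) (ogog : IsOgog n O) where
  open IsOgog ogog

  +1≡suc : ∀ x → x + 1 ≡ suc x
  +1≡suc x = +-comm x 1

  row-monotone : ∀ {i} → i ≤ n ∸ 1 → MonotoneOn i (O i)
  row-monotone {i} i≤ = monotoneOn-fromStep λ {x} 1≤x x<i →
    subst (λ y → InRange n i y → O i x ≤ O i y) (+1≡suc x)
      (rowInc i x (1≤x , ≤-trans (n≤1+n x) x<i , i≤))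
      (s≤s z≤n , x<i , i≤)

  column-step : ∀ {i j} → suc i ≤ n ∸ 1 → 1 ≤ j → j ≤ i → O (suc i) j ≤ O i j
  column-step {i} {j} i<n 1≤j j≤i =
    subst (λ x → InRange n x j → O x j ≤ O i j) (+1≡suc i)
      (colDec i j (1≤j , j≤i , ≤-trans (n≤1+n i) i<n))
      (1≤j , m≤n⇒m≤1+n j≤i , i<n)

  diagonal-step : ∀ {i j} → suc i ≤ n ∸ 1 → 1 ≤ j → j ≤ i →
                  O i j ≤ O (suc i) (suc j) + 1
  diagonal-step {i} {j} i<n 1≤j j≤i =
    subst₂ (λ x y → InRange n x y → O i j ≤ O x y + 1) (+1≡suc i) (+1≡suc j)
      (diagCond i j (1≤j , j≤i , ≤-trans (n≤1+n i) i<n))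
      (s≤s z≤n , s≤s j≤i , i<n)

  H : ℕ → ℕ → ℕ
  H a k = lastBelow (O (n ∸ a)) k (n ∸ a)

  transposed-rows : ∀ {a} → 1 ≤ a → a + 1 ≤ n ∸ 1 →
                    n ∸ a ≡ suc (n ∸ (a + 1)) × suc (n ∸ (a + 1)) ≤ n ∸ 1
  transposed-rows {a} 1≤a a+1≤ = n∸a≡ , subst (_≤ n ∸ 1) n∸a≡ (∸-monoʳ-≤ n 1≤a)
    where
    n∸a≡ : n ∸ a ≡ suc (n ∸ (a + 1))
    n∸a≡ = subst (λ b → n ∸ a ≡ suc (n ∸ b)) (sym (+1≡suc a))
             (∸-suc-step (subst (_≤ n) (+1≡suc a) (≤-trans a+1≤ (m∸n≤m n 1))))

  H-colDec : ∀ {a} k → 1 ≤ a → a + 1 ≤ n ∸ 1 → H (a + 1) k ≤ H a k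
  H-colDec {a} k 1≤a a+1≤ with transposed-rows 1≤a a+1≤
  ... | n∸a≡ , i<n rewrite n∸a≡ =
    lastBelow-mono (column-step i<n) ≤-refl (n≤1+n _)

  H-diagCond : ∀ {a} k → 1 ≤ a → a + 1 ≤ n ∸ 1 → H a k ≤ H (a + 1) (k + 1) + 1
  H-diagCond {a} k 1≤a a+1≤ with transposed-rows 1≤a a+1≤
  ... | n∸a≡ , i<n rewrite n∸a≡ = lastBelow-shift (diagonal-step i<n)

  H-isOgog : IsOgog n H
  H-isOgog = record
    { bounded  = λ a k _ → lastBelow-≤ (O (n ∸ a)) k (n ∸ a)
    ; rowInc   = λ a k _ _ →
                   lastBelow-mono {m = n ∸ a} (λ _ _ → ≤-refl) (m≤m+n k 1) ≤-refl
    ; colDec   = λ { a k (1≤k , k≤a , _) (_ , _ , a+1≤) →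
                       H-colDec k (≤-trans 1≤k k≤a) a+1≤ }
    ; diagCond = λ { a k (1≤k , k≤a , _) (_ , _ , a+1≤) →
                       H-diagCond k (≤-trans 1≤k k≤a) a+1≤ }
    }

  H-white⇔O-gray : ∀ i j k → IsCubePos n i j k → (White H (n ∸ i) k j ⇔ Gray O i j k)
  H-white⇔O-gray i j k ((1≤j , j≤i , i≤) , _) =
    subst (λ r → (j ≤ lastBelow (O r) k r) ⇔ (O i j < k))
      (sym (m∸[m∸n]≡n (≤-trans i≤ (m∸n≤m n 1))))
      (≤-lastBelow⇔ (row-monotone i≤) 1≤j j≤i)

mainTheorem7 : (n : ℕ) → 2 ≤ n → (O : ℕ → ℕ → ℕ) → IsOgog n O →
    Σ (ℕ → ℕ → ℕ) (λ H → IsOgog n H ×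
      (∀ i j k → IsCubePos n i j k → (White H (n ∸ i) k j ⇔ Gray O i j k)))
mainTheorem7 n _ O ogog = H , H-isOgog , H-white⇔O-gray
  where open Transpose n O ogog
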